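{- Let $G$ be a graph with $G\in\mathfrak{N}$ and let $n\geq 1$ be an integer. Then $G[nK_1]\in\mathfrak{N}$. Moreover, $w(G[nK_1])\leq w(G)\cdot n$ and $W(G[nK_1])\geq (W(G)+1)\cdot n-1$.
   Context: All graphs are finite, undirected, without loops or multiple edges. An edge coloring of a graph $G$ with colors $1,2,\ldots,t$ is an interval $t$-coloring if every color $i\in\{1,\ldots,t\}$ is used on at least one edge, and for every vertex $v$ the colors of the edges incident to $v$ are pairwise distinct and form an interval of consecutive integers. $G$ is interval colorable if it has an interval $t$-coloring for some integer $t\geq 1$; $\mathfrak{N}$ denotes the set of interval colorable graphs. For $G\in\mathfrak{N}$, $w(G)$ and $W(G)$ denote the least and greatest $t$ for which $G$ has an interval $t$-coloring. $nK_1$ is the edgeless graph on $n$ vertices. The lexicographic product $G[H]$ has vertex set $V(G)\times V(H)$, with $(u_1,v_1)$ adjacent to $(u_2,v_2)$ iff either $u_1u_2\in E(G)$, or ($u_1=u_2$ and $v_1v_2\in E(H)$). -}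

module Defs where

open import Data.Nat using (ℕ; _≤_; _*_)
open import Data.Fin using (Fin; remQuot)
open import Data.Product using (Σ; ∃; _×_; _,_; proj₁; proj₂)
open import Data.Sum using (_⊎_; inj₁; inj₂)
open import Data.Empty using (⊥)
open import Relation.Nullary using (¬_)
open import Relation.Binary.PropositionalEquality using (_≡_; refl)

record Graph : Set₁ where
  field
    size   : ℕ
    Adj    : Fin size → Fin size → Set
    sym    : ∀ {u v} → Adj u v → Adj v u
    irrefl : ∀ {u} → ¬ Adj u u
open Graph public

-- An edge colouring assigns a natural number to every ordered pair of
-- vertices; only its values on edges matter, and it must be symmetric on
-- edges (so it is a colouring of the unordered edge uv).
record IntervalColoring (G : Graph) (t : ℕ) : Set where
  field
    col        : Fin (size G) → Fin (size G) → ℕ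
    col-sym    : ∀ {u v} → Adj G u v → col u v ≡ col v u
    col-range  : ∀ {u v} → Adj G u v → 1 ≤ col u v × col u v ≤ t
    col-used   : ∀ i → 1 ≤ i → i ≤ t →
                 Σ (Fin (size G)) λ u → Σ (Fin (size G)) λ v → Adj G u v × col u v ≡ i
    col-proper : ∀ {u v w} → Adj G u v → Adj G u w → col u v ≡ col u w → v ≡ w
    col-interval : ∀ {u v w} → Adj G u v → Adj G u w → ∀ k →
                   col u v ≤ k → k ≤ col u w →
                   Σ (Fin (size G)) λ x → Adj G u x × col u x ≡ k

IntervalColorable : Graph → Set
IntervalColorable G = Σ ℕ λ t → 1 ≤ t × IntervalColoring G t

IsLeastSpan : Graph → ℕ → Set
IsLeastSpan G m = (1 ≤ m × IntervalColoring G m) ×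
                  (∀ t → 1 ≤ t → IntervalColoring G t → m ≤ t)

IsGreatestSpan : Graph → ℕ → Set
IsGreatestSpan G M = (1 ≤ M × IntervalColoring G M) ×
                     (∀ t → 1 ≤ t → IntervalColoring G t → t ≤ M)

edgeless : ℕ → Graph
edgeless n = record { size = n ; Adj = λ _ _ → ⊥ ; sym = λ () ; irrefl = λ () }

-- Lexicographic product G[H]; its vertex set Fin (size G * size H) is
-- identified with Fin (size G) × Fin (size H) via the bijection remQuot.
module _ (G H : Graph) where
  private
    p : Fin (size G * size H) → Fin (size G) × Fin (size H)
    p = remQuot (size H)

    LAdj : Fin (size G * size H) → Fin (size G * size H) → Set
    LAdj x y = Adj G (proj₁ (p x)) (proj₁ (p y)) ⊎
               (proj₁ (p x) ≡ proj₁ (p y) × Adj H (proj₂ (p x)) (proj₂ (p y)))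

    LSym : ∀ {x y} → LAdj x y → LAdj y x
    LSym (inj₁ a) = inj₁ (sym G a)
    LSym (inj₂ (e , a)) = inj₂ (Relation.Binary.PropositionalEquality.sym e , sym H a)

    LIrr : ∀ {x} → ¬ LAdj x x
    LIrr (inj₁ a) = irrefl G a
    LIrr (inj₂ (_ , a)) = irrefl H a

  lex : Graph
  lex = record { size = size G * size H ; Adj = LAdj ; sym = LSym ; irrefl = LIrr }

_[_] : Graph → Graph → Graph
G [ H ] = lex G H

-- Blow every edge uv of G, coloured c, up into the complete bipartite block between the n
-- copies of u and of v, and colour that block with (c − 1)·n + 1 + P(i,j) for an n × n
-- array P whose rows are permutations of intervals of length n and whose entries fill
-- {0,…,B−1}.  At the copy (u,i) the colours then form the interval obtained by gluing, for
-- every colour c at u, the block of n colours that row i of P shifts to level c − 1; the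
-- result is an interval ((t − 1)·n + B)-colouring.  P(i,j) = (i + j) mod n has B = n and
-- P(i,j) = i + j has B = 2n − 1, which gives the bounds on w and W.
module Submission where

open import Defs hiding (sym)
open import Data.Nat using (ℕ; suc; _≤_; _<_; _*_; _+_; _∸_; NonZero; z≤n; s≤s; _<?_; >-nonZero⁻¹)
open import Data.Nat.Properties
open import Data.Nat.DivMod
open import Data.Nat.Divisibility using (n∣m*n)
open import Data.Nat.Tactic.RingSolver using (solve-∀)
open import Data.Fin using (Fin; zero; toℕ; fromℕ; fromℕ<; combine; remQuot)
open import Data.Fin.Properties using (toℕ<n; toℕ≤pred[n]; toℕ-injective; toℕ-fromℕ; toℕ-fromℕ<; remQuot-combine; combine-remQuot)
open import Data.Fin.Permutation using (Permutation′; permutation; id; _⟨$⟩ʳ_; _⟨$⟩ˡ_; inverseˡ; inverseʳ)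
open import Data.Product using (_×_; ∃; ∃₂; _,_; proj₁; proj₂; uncurry)
open import Data.Sum using (inj₁)
open import Relation.Binary.PropositionalEquality hiding ([_])
open import Relation.Nullary using (yes; no)

remQuot-injective : ∀ {m} n {x y : Fin (m * n)} → remQuot {m} n x ≡ remQuot n y → x ≡ y
remQuot-injective {m} n {x} {y} eq = begin
  x                                  ≡⟨ combine-remQuot {m} n x ⟨
  uncurry combine (remQuot {m} n x)  ≡⟨ cong (uncurry combine) eq ⟩
  uncurry combine (remQuot {m} n y)  ≡⟨ combine-remQuot {m} n y ⟩
  y                                  ∎
  where open ≡-Reasoning

module _ {n : ℕ} .{{_ : NonZero n}} where

  [m*n+o]%n≡o : ∀ m {o} → o < n → (m * n + o) % n ≡ o
  [m*n+o]%n≡o m {o} o<n = begin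
    (m * n + o) % n  ≡⟨ cong (_% n) (+-comm (m * n) o) ⟩
    (o + m * n) % n  ≡⟨ [m+kn]%n≡m%n o m n ⟩
    o % n            ≡⟨ m<n⇒m%n≡m o<n ⟩
    o                ∎
    where open ≡-Reasoning

  [m*n+o]/n≡m : ∀ m {o} → o < n → (m * n + o) / n ≡ m
  [m*n+o]/n≡m m {o} o<n = begin
    (m * n + o) / n    ≡⟨ +-distrib-/-∣ˡ o (n∣m*n m) ⟩
    m * n / n + o / n  ≡⟨ cong₂ _+_ (m*n/n≡m m n) (m<n⇒m/n≡0 o<n) ⟩
    m + 0              ≡⟨ +-identityʳ m ⟩
    m                  ∎
    where open ≡-Reasoning

  *-+-injective : ∀ {m m′ o o′} → o < n → o′ < n → m * n + o ≡ m′ * n + o′ → m ≡ m′ × o ≡ o′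
  *-+-injective {m} {m′} {o} {o′} o<n o′<n eq =
      trans (sym ([m*n+o]/n≡m m o<n)) (trans (cong (_/ n) eq) ([m*n+o]/n≡m m′ o′<n))
    , trans (sym ([m*n+o]%n≡o m o<n)) (trans (cong (_% n) eq) ([m*n+o]%n≡o m′ o′<n))

  m*n+o≤k⇒m≤k/n : ∀ m {o k} → m * n + o ≤ k → m ≤ k / n
  m*n+o≤k⇒m≤k/n m {o} le = subst (_≤ _) (m*n/n≡m m n) (/-monoˡ-≤ n (≤-trans (m≤m+n (m * n) o) le))

  k≤m*n+o⇒k/n≤m : ∀ m {o k} → o < n → k ≤ m * n + o → k / n ≤ m
  k≤m*n+o⇒k/n≤m m o<n le = ≤-trans (/-monoˡ-≤ n le) (≤-reflexive ([m*n+o]/n≡m m o<n))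

  k<m*n+b⇒k≡q*n+r : ∀ m {b k} → n ≤ b → k < m * n + b →
                    ∃₂ λ q r → q ≤ m × r < b × k ≡ q * n + r
  k<m*n+b⇒k≡q*n+r m {b} {k} n≤b k< with k <? m * n
  ... | yes k<m*n = k / n , k % n , <⇒≤ (m<n*o⇒m/o<n k<m*n) , ≤-trans (m%n<n k n) n≤b ,
                    trans (m≡m%n+[m/n]*n k n) (+-comm (k % n) _)
  ... | no k≮m*n  = m , k ∸ m * n , ≤-refl ,
                    +-cancelˡ-< (m * n) _ _ (subst (_< m * n + b) (sym k≡m*n+r) k<) , sym k≡m*n+r
    where k≡m*n+r = m+[n∸m]≡n (≮⇒≥ k≮m*n)

  [m+n%d]%d≡[m+n]%d : ∀ m o → (m + o % n) % n ≡ (m + o) % n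
  [m+n%d]%d≡[m+n]%d m o = begin
    (m + o % n) % n            ≡⟨ %-distribˡ-+ m (o % n) n ⟩
    (m % n + o % n % n) % n    ≡⟨ cong (λ r → (m % n + r) % n) (m%n%n≡m%n o n) ⟩
    (m % n + o % n) % n        ≡⟨ %-distribˡ-+ m o n ⟨
    (m + o) % n                ∎
    where open ≡-Reasoning

  rotation-cancel : ∀ k l (j : Fin n) → k + l ≡ n → toℕ ((k + toℕ ((l + toℕ j) mod n)) mod n) ≡ toℕ j
  rotation-cancel k l j k+l≡n = begin
    toℕ ((k + toℕ ((l + toℕ j) mod n)) mod n)  ≡⟨ toℕ-fromℕ< _ ⟩
    (k + toℕ ((l + toℕ j) mod n)) % n          ≡⟨ cong (λ r → (k + r) % n) (toℕ-fromℕ< _) ⟩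
    (k + (l + toℕ j) % n) % n                  ≡⟨ [m+n%d]%d≡[m+n]%d k (l + toℕ j) ⟩
    (k + (l + toℕ j)) % n                      ≡⟨ cong (_% n) (trans (sym (+-assoc k l _)) (cong (_+ toℕ j) k+l≡n)) ⟩
    (n + toℕ j) % n                            ≡⟨ cong (_% n) (+-comm n (toℕ j)) ⟩
    (toℕ j + n) % n                            ≡⟨ [m+n]%n≡m%n (toℕ j) n ⟩
    toℕ j % n                                  ≡⟨ m<n⇒m%n≡m (toℕ<n j) ⟩
    toℕ j                                      ∎
    where open ≡-Reasoning

  rotation : Fin n → Permutation′ n
  rotation i = permutation (λ j → (toℕ i + toℕ j) mod n) (λ j → (n ∸ toℕ i + toℕ j) mod n)
    (λ j → toℕ-injective (rotation-cancel (toℕ i) (n ∸ toℕ i) j (m+[n∸m]≡n i≤n)))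
    (λ j → toℕ-injective (rotation-cancel (n ∸ toℕ i) (toℕ i) j (m∸n+n≡m i≤n)))
    where i≤n = <⇒≤ (toℕ<n i)

-- Equivalently, a symmetric interval colouring of the complete bipartite graph K_{n,n} with
-- the colours 0,…,B−1 in which the edges at the i-th vertex use the interval starting at
-- offset i.
record BlockPattern (n B : ℕ) : Set where
  field
    offset : Fin n → ℕ
    row    : Fin n → Permutation′ n

  entry : Fin n → Fin n → ℕ
  entry i j = offset i + toℕ (row i ⟨$⟩ʳ j)

  field
    entry-sym  : ∀ i j → entry i j ≡ entry j i
    entry-<    : ∀ i j → entry i j < B
    entry-onto : ∀ r → r < B → ∃₂ λ i j → entry i j ≡ r

width≤colours : ∀ {n B} → BlockPattern n B → n ≤ B
width≤colours {ℕ.zero}  _ = z≤n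
width≤colours {suc n} P = begin
  suc n                                  ≡⟨ cong suc (toℕ-fromℕ n) ⟨
  suc (toℕ (fromℕ n))                    ≡⟨ cong (λ k → suc (toℕ k)) (inverseʳ (row zero)) ⟨
  suc (toℕ (row zero ⟨$⟩ʳ j))            ≤⟨ s≤s (m≤n+m _ (offset zero)) ⟩
  suc (entry zero j)                     ≤⟨ entry-< zero j ⟩
  _                                      ∎
  where
  open BlockPattern P
  open ≤-Reasoning
  j = row zero ⟨$⟩ˡ fromℕ n

cyclicPattern : ∀ n → BlockPattern (suc n) (suc n)
cyclicPattern n = record
  { offset     = λ _ → 0
  ; row        = rotation
  ; entry-sym  = λ i j → cong (λ m → toℕ (m mod suc n)) (+-comm (toℕ i) (toℕ j))
  ; entry-<    = λ _ _ → toℕ<n _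
  ; entry-onto = λ r r<n → zero , fromℕ< r<n , (begin
      toℕ (toℕ (fromℕ< r<n) mod suc n)  ≡⟨ toℕ-fromℕ< _ ⟩
      toℕ (fromℕ< r<n) % suc n          ≡⟨ cong (_% suc n) (toℕ-fromℕ< r<n) ⟩
      r % suc n                         ≡⟨ m<n⇒m%n≡m r<n ⟩
      r                                 ∎)
  }
  where open ≡-Reasoning

sumPattern : ∀ n → BlockPattern (suc n) (n + suc n)
sumPattern n = record
  { offset     = toℕ
  ; row        = λ _ → id
  ; entry-sym  = λ i j → +-comm (toℕ i) (toℕ j)
  ; entry-<    = λ i j → +-mono-≤-< (toℕ≤pred[n] i) (toℕ<n j)
  ; entry-onto = onto
  }
  where
  onto : ∀ r → r < n + suc n → ∃₂ λ (i j : Fin (suc n)) → toℕ i + toℕ j ≡ r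
  onto r r< with r <? suc n
  ... | yes r<1+n = zero , fromℕ< r<1+n , toℕ-fromℕ< r<1+n
  ... | no  r≮1+n = fromℕ n , fromℕ< (m<n+o⇒m∸n<o r n r<) ,
                    trans (cong₂ _+_ (toℕ-fromℕ n) (toℕ-fromℕ< _)) (m+[n∸m]≡n (<⇒≤ (≮⇒≥ r≮1+n)))

module LexColouring {G : Graph} {t : ℕ} (1≤t : 1 ≤ t) (C : IntervalColoring G t)
                    {n B : ℕ} .{{_ : NonZero n}} (P : BlockPattern n B) where
  open IntervalColoring C
  open BlockPattern P

  private
    L : Graph
    L = G [ edgeless n ]

  block : Fin (size L) → Fin (size G)
  block x = proj₁ (remQuot {size G} n x)

  copy : Fin (size L) → Fin n
  copy x = proj₂ (remQuot {size G} n x)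

  block-combine : ∀ u i → block (combine u i) ≡ u
  block-combine u i = cong proj₁ (remQuot-combine {size G} {n} u i)

  copy-combine : ∀ (u : Fin (size G)) i → copy (combine u i) ≡ i
  copy-combine u i = cong proj₂ (remQuot-combine {size G} {n} u i)

  adjacent-blocks : ∀ {x y} → Adj L x y → Adj G (block x) (block y)
  adjacent-blocks (inj₁ uv) = uv

  adjacent-combine : ∀ {x v} j → Adj G (block x) v → Adj L x (combine v j)
  adjacent-combine {x} j uv = inj₁ (subst (Adj G (block x)) (sym (block-combine _ j)) uv)

  level : Fin (size G) → Fin (size G) → ℕ
  level u v = col u v ∸ 1

  suc-level : ∀ {u v} → Adj G u v → suc (level u v) ≡ col u v
  suc-level uv = m+[n∸m]≡n (proj₁ (col-range uv))

  colour : Fin (size L) → Fin (size L) → ℕ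
  colour x y = level (block x) (block y) * n + suc (entry (copy x) (copy y))

  span : ℕ
  span = (t ∸ 1) * n + B

  1≤span : 1 ≤ span
  1≤span = ≤-trans (>-nonZero⁻¹ n) (≤-trans (width≤colours P) (m≤n+m B _))

  colour-in-row : ∀ x y → colour x y ≡
    suc (offset (copy x) + (level (block x) (block y) * n + toℕ (row (copy x) ⟨$⟩ʳ copy y)))
  colour-in-row x y =
    rearrange (level (block x) (block y) * n) (offset (copy x)) (toℕ (row (copy x) ⟨$⟩ʳ copy y))
    where
    rearrange : ∀ a o r → a + suc (o + r) ≡ suc (o + (a + r))
    rearrange = solve-∀

  colour-combine : ∀ u i v j → colour (combine u i) (combine v j) ≡ level u v * n + suc (entry i j)
  colour-combine u i v j = cong₂ (λ p q → level (proj₁ p) (proj₁ q) * n + suc (entry (proj₂ p) (proj₂ q)))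
    (remQuot-combine {size G} {n} u i) (remQuot-combine {size G} {n} v j)

  colour-sym : ∀ {x y} → Adj L x y → colour x y ≡ colour y x
  colour-sym {x} {y} xy =
    cong₂ (λ c e → (c ∸ 1) * n + suc e) (col-sym (adjacent-blocks xy)) (entry-sym (copy x) (copy y))

  colour-range : ∀ {x y} → Adj L x y → 1 ≤ colour x y × colour x y ≤ span
  colour-range {x} {y} xy =
      ≤-trans (s≤s z≤n) (m≤n+m _ _)
    , +-mono-≤ (*-monoˡ-≤ n (∸-monoˡ-≤ 1 (proj₂ (col-range (adjacent-blocks xy))))) (entry-< _ _)

  colour-used : ∀ k → 1 ≤ k → k ≤ span → ∃₂ λ x y → Adj L x y × colour x y ≡ k
  colour-used (suc k) _ k<span
    with q , r , q≤t∸1 , r<B , k≡q*n+r ← k<m*n+b⇒k≡q*n+r (t ∸ 1) (width≤colours P) k<span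
    with u , v , uv , col≡1+q ← col-used (suc q) (s≤s z≤n) (≤-trans (s≤s q≤t∸1) (≤-reflexive (m+[n∸m]≡n 1≤t)))
    with i , j , entry≡r ← entry-onto r r<B
    = combine u i , combine v j , adjacent-combine j (subst (λ w → Adj G w v) (sym (block-combine u i)) uv) , (begin
      colour (combine u i) (combine v j)  ≡⟨ colour-combine u i v j ⟩
      level u v * n + suc (entry i j)     ≡⟨ cong₂ (λ a e → a * n + suc e) (cong (_∸ 1) col≡1+q) entry≡r ⟩
      q * n + suc r                       ≡⟨ +-suc (q * n) r ⟩
      suc (q * n + r)                     ≡⟨ cong suc k≡q*n+r ⟨
      suc k                               ∎)
    where open ≡-Reasoning

  colour-proper : ∀ {x y y′} → Adj L x y → Adj L x y′ → colour x y ≡ colour x y′ → y ≡ y′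
  colour-proper {x} {y} {y′} xy xy′ eq = remQuot-injective {size G} n (cong₂ _,_ same-block same-copy)
    where
    σ = row (copy x)
    same-position : level (block x) (block y) ≡ level (block x) (block y′)
                  × toℕ (σ ⟨$⟩ʳ copy y) ≡ toℕ (σ ⟨$⟩ʳ copy y′)
    same-position = *-+-injective (toℕ<n _) (toℕ<n _) (+-cancelˡ-≡ (offset (copy x)) _ _
      (suc-injective (trans (sym (colour-in-row x y)) (trans eq (colour-in-row x y′)))))
    same-block : block y ≡ block y′
    same-block = col-proper (adjacent-blocks xy) (adjacent-blocks xy′)
      (trans (sym (suc-level (adjacent-blocks xy)))
        (trans (cong suc (proj₁ same-position)) (suc-level (adjacent-blocks xy′))))
    same-copy : copy y ≡ copy y′
    same-copy = trans (sym (inverseˡ σ))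
      (trans (cong (σ ⟨$⟩ˡ_) (toℕ-injective (proj₂ same-position))) (inverseˡ σ))

  colour-interval : ∀ {x y y′} → Adj L x y → Adj L x y′ → ∀ k → colour x y ≤ k → k ≤ colour x y′ →
                    ∃ λ z → Adj L x z × colour x z ≡ k
  colour-interval {x} {y} {y′} xy xy′ k lo hi = combine w j , adjacent-combine j uw , (begin
      colour x (combine w j)                                     ≡⟨ colour-in-row x (combine w j) ⟩
      suc (o + (level u (block (combine w j)) * n + toℕ (σ ⟨$⟩ʳ copy (combine w j))))
        ≡⟨ cong₂ (λ v i → suc (o + (level u v * n + toℕ (σ ⟨$⟩ʳ i)))) (block-combine w j) (copy-combine w j) ⟩
      suc (o + (level u w * n + toℕ (σ ⟨$⟩ʳ j)))
        ≡⟨ cong₂ (λ a r → suc (o + (a * n + r))) (cong (_∸ 1) col≡1+q) (trans (cong toℕ (inverseʳ σ)) (toℕ-fromℕ< _)) ⟩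
      suc (o + (q * n + k′ % n))                                 ≡⟨ cong (λ r → suc (o + r)) (+-comm (q * n) _) ⟩
      suc (o + (k′ % n + q * n))                                 ≡⟨ cong (λ r → suc (o + r)) (m≡m%n+[m/n]*n k′ n) ⟨
      suc o + k′                                                 ≡⟨ m+[n∸m]≡n 1+o≤k ⟩
      k                                                          ∎)
    where
    open ≡-Reasoning
    u = block x
    o = offset (copy x)
    σ = row (copy x)
    a a′ s : ℕ
    a  = level u (block y)
    a′ = level u (block y′)
    s  = toℕ (σ ⟨$⟩ʳ copy y)
    lo′ : suc o + (a * n + s) ≤ k
    lo′ = subst (_≤ k) (colour-in-row x y) lo
    1+o≤k : suc o ≤ k
    1+o≤k = ≤-trans (m≤m+n (suc o) _) lo′
    -- k = 1 + o + k′, where k′ sits at level q = k′ / n and position k′ % n of row (copy x).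
    k′ q : ℕ
    k′ = k ∸ suc o
    q  = k′ / n
    a≤q : a ≤ q
    a≤q = m*n+o≤k⇒m≤k/n a (+-cancelˡ-≤ (suc o) _ _ (subst (suc o + (a * n + s) ≤_) (sym (m+[n∸m]≡n 1+o≤k)) lo′))
    q≤a′ : q ≤ a′
    q≤a′ = k≤m*n+o⇒k/n≤m a′ (toℕ<n _) (+-cancelˡ-≤ (suc o) _ _
      (subst₂ _≤_ (sym (m+[n∸m]≡n 1+o≤k)) (colour-in-row x y′) hi))
    neighbour : ∃ λ w → Adj G u w × col u w ≡ suc q
    neighbour = col-interval (adjacent-blocks xy) (adjacent-blocks xy′) (suc q)
      (≤-trans (≤-reflexive (sym (suc-level (adjacent-blocks xy)))) (s≤s a≤q))
      (≤-trans (s≤s q≤a′) (≤-reflexive (suc-level (adjacent-blocks xy′))))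
    w = proj₁ neighbour
    uw = proj₁ (proj₂ neighbour)
    col≡1+q = proj₂ (proj₂ neighbour)
    j = σ ⟨$⟩ˡ (k′ mod n)

  colouring : IntervalColoring L span
  colouring = record
    { col          = colour
    ; col-sym      = colour-sym
    ; col-range    = colour-range
    ; col-used     = colour-used
    ; col-proper   = colour-proper
    ; col-interval = colour-interval
    }

[m∸1]*n+n≡m*n : ∀ m n → 1 ≤ m → (m ∸ 1) * n + n ≡ m * n
[m∸1]*n+n≡m*n (suc m) n _ = +-comm (m * n) n

[m∸1]*n+[n∸1+n]≡[m+1]*n∸1 : ∀ m n → 1 ≤ m → (m ∸ 1) * suc n + (n + suc n) ≡ (m + 1) * suc n ∸ 1
[m∸1]*n+[n∸1+n]≡[m+1]*n∸1 (suc m) n _ = rearrange m n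
  where
  rearrange : ∀ m n → m * suc n + (n + suc n) ≡ n + (m + 1) * suc n
  rearrange = solve-∀

theorem16 : (G : Graph) → IntervalColorable G → (n : ℕ) → 1 ≤ n →
    IntervalColorable (G [ edgeless n ]) ×
    (∀ a b → IsLeastSpan (G [ edgeless n ]) a → IsLeastSpan G b → a ≤ b * n) ×
    (∀ A B → IsGreatestSpan (G [ edgeless n ]) A → IsGreatestSpan G B → (B + 1) * n ∸ 1 ≤ A)
theorem16 G (t , 1≤t , C) n@(suc n′) _ =
  (Sum.span , Sum.1≤span , Sum.colouring) , least-bound , greatest-bound
  where
  module Sum = LexColouring 1≤t C (sumPattern n′)

  least-bound : ∀ a b → IsLeastSpan (G [ edgeless n ]) a → IsLeastSpan G b → a ≤ b * n
  least-bound _ b (_ , least) ((1≤b , Cb) , _) =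
    least (b * n) (subst (1 ≤_) span≡b*n 1≤span) (subst (IntervalColoring _) span≡b*n colouring)
    where
    open LexColouring 1≤b Cb (cyclicPattern n′)
    span≡b*n = [m∸1]*n+n≡m*n b n 1≤b

  greatest-bound : ∀ A B → IsGreatestSpan (G [ edgeless n ]) A → IsGreatestSpan G B → (B + 1) * n ∸ 1 ≤ A
  greatest-bound A B (_ , greatest) ((1≤B , CB) , _) =
    subst (_≤ A) ([m∸1]*n+[n∸1+n]≡[m+1]*n∸1 B n′ 1≤B) (greatest _ 1≤span colouring)
    where open LexColouring 1≤B CB (sumPattern n′)
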